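{- For $\gamma\ge1$ let $\mathbb{K}\langle\mathbf{CAs}^{(\gamma)}\rangle:=\mathbb{K}\langle \mathbf{Mag}\rangle/_{I_\gamma}$, where $I_\gamma$ is the operad ideal generated by $\mathrm{LComb}_\gamma-\mathrm{RComb}_\gamma$, and let $\mathbb{K}\langle\mathbf{CAs}\rangle$ be the set of these operads. Write $\mathbb{K}\langle\mathbf{CAs}^{(\gamma)}\rangle\preceq_{\mathrm{d}}\mathbb{K}\langle\mathbf{CAs}^{(\gamma')}\rangle$ when there exists a nonzero morphism of linear operads $\mathbb{K}\langle\mathbf{CAs}^{(\gamma')}\rangle\to\mathbb{K}\langle\mathbf{CAs}^{(\gamma)}\rangle$. Then the inclusion $\iota:(\mathbb{K}\langle\mathbf{CAs}\rangle,\preceq_{\mathrm{d}})\to(\mathcal{Q},\preceq_{\mathrm{i}})$ is nondecreasing. Moreover, for all positive integers $\gamma,\gamma'$, $$\mathbb{K}\langle\mathbf{CAs}^{(\gcd(\gamma-1,\gamma'-1)+1)}\rangle\preceq_{\mathrm{i}}\mathbb{K}\langle\mathbf{CAs}^{(\gamma)}\rangle\wedge_{\mathrm{i}}\mathbb{K}\langle\mathbf{CAs}^{(\gamma')}\rangle$$ and $$\mathbb{K}\langle\mathbf{CAs}^{(\gamma)}\rangle\vee_{\mathrm{i}}\mathbb{K}\langle\mathbf{CAs}^{(\gamma')}\rangle\preceq_{\mathrm{i}}\mathbb{K}\langle\mathbf{CAs}^{(\mathrm{lcm}(\gamma-1,\gamma'-1)+1)}\rangle.$$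
   Context: $\mathbb{K}$ is a field of characteristic zero. A binary tree is either the leaf or an ordered pair of binary trees; $\mathbf{Mag}(n)$ is the set of binary trees with $n$ leaves and the nonsymmetric operad $\mathbf{Mag}$ has partial compositions grafting a tree's root onto the $i$-th leaf of another. $\mathbb{K}\langle \mathbf{Mag}\rangle$ is the linear operad with $\mathbb{K}\langle \mathbf{Mag}\rangle(n)$ having basis $\mathbf{Mag}(n)$. Combs: $\mathrm{LComb}_1=\mathrm{RComb}_1=(\text{leaf},\text{leaf})$, $\mathrm{LComb}_d=(\mathrm{LComb}_{d-1},\text{leaf})$, $\mathrm{RComb}_d=(\text{leaf},\mathrm{RComb}_{d-1})$. An operad ideal is a family of subspaces $I(n)$ stable under partial compositions with arbitrary elements on either side. $\mathcal{Q}$ is the set of quotients $\mathbb{K}\langle \mathbf{Mag}\rangle/_I$ over all operad ideals $I$. For $\mathcal{O}_j=\mathbb{K}\langle \mathbf{Mag}\rangle/_{I_j}$: $\mathcal{O}_2\preceq_{\mathrm{i}}\mathcal{O}_1$ iff there exists a nonzero morphism of linear operads $\mathcal{O}_1\to\mathcal{O}_2$ (arity-preserving linear maps commuting with partial compositions, nonzero on the binary generator); $\mathcal{O}_1\wedge_{\mathrm{i}}\mathcal{O}_2:=\mathbb{K}\langle \mathbf{Mag}\rangle/_{I_1+I_2}$ and $\mathcal{O}_1\vee_{\mathrm{i}}\mathcal{O}_2:=\mathbb{K}\langle \mathbf{Mag}\rangle/_{I_1\cap I_2}$. $\gcd$, $\mathrm{lcm}$ on $\mathbb{N}$ with $\gcd(0,a)=a$,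 $\mathrm{lcm}(0,a)=0$. -}

module Defs where

open import Level using (Level; _⊔_)
open import Algebra.Bundles using (CommutativeRing)
open import Data.Nat as ℕ using (ℕ; zero; suc; _+_; _∸_; _<_; _<ᵇ_)
open import Data.Bool using (if_then_else_)
open import Data.List using (List; []; _∷_; _++_; map; concatMap)
open import Data.List.Relation.Unary.All using (All)
open import Data.Product using (_×_; _,_; proj₁; proj₂; Σ; ∃)
open import Relation.Nullary using (¬_; Dec; yes; no)
open import Relation.Binary.PropositionalEquality using (_≡_; refl; cong₂)

record Field (c ℓ : Level) : Set (Level.suc (c ⊔ ℓ)) where
  field
    commutativeRing : CommutativeRing c ℓ
  open CommutativeRing commutativeRing public
  field
    1≉0     : ¬ (1# ≈ 0#)
    inverse : ∀ x → ¬ (x ≈ 0#) → Σ Carrier (λ y → (x * y) ≈ 1#)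

natCast : ∀ {c ℓ} (F : Field c ℓ) → ℕ → Field.Carrier F
natCast F zero    = Field.0# F
natCast F (suc n) = Field._+_ F (Field.1# F) (natCast F n)

CharZero : ∀ {c ℓ} → Field c ℓ → Set ℓ
CharZero F = ∀ n → ¬ (Field._≈_ F (natCast F (suc n)) (Field.0# F))

-- Binary trees (the magmatic operad Mag)

data Tree : Set where
  leaf : Tree
  node : Tree → Tree → Tree

leaves : Tree → ℕ
leaves leaf       = 1
leaves (node l r) = leaves l + leaves r

_≟T_ : (s t : Tree) → Dec (s ≡ t)
leaf ≟T leaf = yes refl
leaf ≟T node _ _ = no (λ ())
node _ _ ≟T leaf = no (λ ())
node a b ≟T node c d with a ≟T c | b ≟T d
... | yes p | yes q = yes (cong₂ node p q)
... | no ¬p | _     = no (λ { refl → ¬p refl })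
... | yes _ | no ¬q = no (λ { refl → ¬q refl })

-- partial composition t ∘_i s : graft the root of s on the i-th leaf
-- of t (leaves numbered 0,1,...,leaves t - 1 from left to right)
graft : Tree → ℕ → Tree → Tree
graft leaf zero    s = s
graft leaf (suc i) s = leaf
graft (node l r) i s =
  if i <ᵇ leaves l then node (graft l i s) r
                   else node l (graft r (i ∸ leaves l) s)

LComb : ℕ → Tree
LComb zero    = leaf
LComb (suc d) = node (LComb d) leaf

RComb : ℕ → Tree
RComb zero    = leaf
RComb (suc d) = node leaf (RComb d)

module WithField {c ℓ} (F : Field c ℓ) where
  open Field F renaming (Carrier to K; _+_ to _+K_; _*_ to _*K_; _≈_ to _≈K_)

  -- formal linear combinations of trees
  Elt : Set c
  Elt = List (K × Tree)

  -- x ∈ K⟨Mag⟩(n): all trees occurring in x have n leaves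
  Hom : ℕ → Elt → Set c
  Hom n x = All (λ p → leaves (proj₂ p) ≡ n) x

  coeff : Elt → Tree → K
  coeff []             t = 0#
  coeff ((a , s) ∷ x)  t with s ≟T t
  ... | yes _ = a +K coeff x t
  ... | no  _ = coeff x t

  _≈_ : Elt → Elt → Set ℓ
  x ≈ y = ∀ t → coeff x t ≈K coeff y t

  zeroE : Elt
  zeroE = []

  _⊕_ : Elt → Elt → Elt
  x ⊕ y = x ++ y

  scale : K → Elt → Elt
  scale a = map (λ p → (a *K proj₁ p , proj₂ p))

  _⊖_ : Elt → Elt → Elt
  x ⊖ y = x ++ scale (- 1#) y

  comp : Elt → ℕ → Elt → Elt
  comp x i y = concatMap (λ p → map (λ q → (proj₁ p *K proj₁ q , graft (proj₂ p) i (proj₂ q))) y) x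

  gen : Elt
  gen = (1# , node leaf leaf) ∷ []

  Family : Set (Level.suc (c ⊔ ℓ))
  Family = ℕ → Elt → Set (c ⊔ ℓ)

  -- the operad ideal generated by an element r of arity k
  data Gen (r : Elt) (k : ℕ) : Family where
    base  : Hom k r → Gen r k k r
    zero∈ : ∀ n → Gen r k n zeroE
    add   : ∀ {n x y} → Gen r k n x → Gen r k n y → Gen r k n (x ⊕ y)
    smul  : ∀ {n x} a → Gen r k n x → Gen r k n (scale a x)
    resp  : ∀ {n x y} → Hom n y → x ≈ y → Gen r k n x → Gen r k n y
    compL : ∀ {n m x y} i → i < n → Gen r k n x → Hom m y →
            Gen r k (n + m ∸ 1) (comp x i y)
    compR : ∀ {n m x y} i → i < n → Hom n y → Gen r k m x →
            Gen r k (n + m ∸ 1) (comp y i x)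

  SumI : Family → Family → Family
  SumI I₁ I₂ n x = Hom n x × ∃ λ y → ∃ λ z → I₁ n y × I₂ n z × (x ≈ (y ⊕ z))

  InterI : Family → Family → Family
  InterI I₁ I₂ n x = I₁ n x × I₂ n x

  -- A quotient K⟨Mag⟩/_I is represented by its ideal I; its elements are
  -- represented by elements of K⟨Mag⟩, two being equal iff their
  -- difference lies in I.
  record Quot : Set (Level.suc (c ⊔ ℓ)) where
    constructor K⟨Mag⟩/
    field ideal : Family

  -- nonzero morphisms of linear operads K⟨Mag⟩/I₁ → K⟨Mag⟩/I₂, given on
  -- representatives
  record Morphism (O₁ O₂ : Quot) : Set (c ⊔ ℓ) where
    I₁ = Quot.ideal O₁
    I₂ = Quot.ideal O₂
    field
      φ       : ℕ → Elt → Elt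
      φ-arity : ∀ n x → Hom n x → Hom n (φ n x)
      φ-wd    : ∀ n x y → Hom n x → Hom n y →
                I₁ n (x ⊖ y) → I₂ n (φ n x ⊖ φ n y)
      φ-add   : ∀ n x y → Hom n x → Hom n y →
                I₂ n (φ n (x ⊕ y) ⊖ (φ n x ⊕ φ n y))
      φ-scale : ∀ n a x → Hom n x → I₂ n (φ n (scale a x) ⊖ scale a (φ n x))
      φ-comp  : ∀ n m i x y → i < n → Hom n x → Hom m y →
                I₂ (n + m ∸ 1) (φ (n + m ∸ 1) (comp x i y) ⊖ comp (φ n x) i (φ m y))
      φ-nonzero : ¬ I₂ 2 (φ 2 gen ⊖ zeroE)

  -- O₂ ⪯ᵢ O₁ iff there is a nonzero morphism O₁ → O₂
  _⪯ᵢ_ : Quot → Quot → Set (c ⊔ ℓ)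
  O₂ ⪯ᵢ O₁ = Morphism O₁ O₂

  _∧ᵢ_ : Quot → Quot → Quot
  O₁ ∧ᵢ O₂ = K⟨Mag⟩/ (SumI (Quot.ideal O₁) (Quot.ideal O₂))

  _∨ᵢ_ : Quot → Quot → Quot
  O₁ ∨ᵢ O₂ = K⟨Mag⟩/ (InterI (Quot.ideal O₁) (Quot.ideal O₂))

  CAs : ℕ → Quot
  CAs γ = K⟨Mag⟩/ (Gen (((1# , LComb γ) ∷ []) ⊖ ((1# , RComb γ) ∷ [])) (suc γ))

  _⪯d_ : ℕ → ℕ → Set (c ⊔ ℓ)
  γ ⪯d γ' = Morphism (CAs γ') (CAs γ)

module Submission where

-- All three maps are the identity on representatives, which is a nonzero
-- morphism as soon as the source ideal lies in the target ideal and the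
-- target ideal misses the generator. Nesting comes from the comb relations:
-- grafting LComb d on the root of LComb (1+a) − RComb (1+a) and RComb a on the
-- last leaf of LComb (1+d) − RComb (1+d) gives two differences telescoping to
-- LComb (1+d+a) − RComb (1+d+a), so I_(1+d) ⊇ I_(1+qd) for every q, i.e.
-- I_γ ⊆ I_γ'' whenever γ'' − 1 divides γ − 1. The generator survives because
-- an ideal generated in arity ≥ 3, or by a null relation, has only null
-- elements in arity 2; proving this needs partial composition to be
-- well defined on the free vector space, which is where the linear
-- extension Λ comes in.

open import Defs
open import Algebra.Properties.CommutativeSemigroup using (xy∙z≈xz∙y)
open import Data.Bool using (T; true; false)
open import Data.Empty using (⊥-elim)
open import Data.Sum using (_⊎_; inj₁; inj₂)
open import Data.Nat using (ℕ; zero; suc; _+_; _*_; _∸_; _≤_; _<_; _<ᵇ_; _<?_; z≤n; s≤s)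
open import Data.Nat.Divisibility using (_∣_; divides)
open import Data.Nat.GCD using (gcd; gcd[m,n]∣m; gcd[m,n]∣n)
open import Data.Nat.LCM using (lcm; m∣lcm[m,n]; n∣lcm[m,n])
open import Data.Nat.Properties
open import Relation.Nullary using (¬_; yes; no)
import Algebra.Properties.Ring
open import Relation.Binary.PropositionalEquality
  using (_≡_; _≢_; refl; sym; trans; cong; subst; module ≡-Reasoning)
import Relation.Binary.Reasoning.Setoid
open import Data.List using ([]; _∷_; _++_; map; length)
open import Data.Product using (_×_; _,_; proj₁; proj₂)
open import Data.List.Relation.Unary.All as All using ([]; _∷_)
open import Data.List.Relation.Unary.All.Properties using (++⁺; map⁺; concat⁺)
open import Relation.Binary.Core using (_⇒_)
open import Function using (_∘_; id)

leaves-LComb : ∀ n → leaves (LComb n) ≡ suc n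
leaves-LComb zero    = refl
leaves-LComb (suc n) = trans (+-comm (leaves (LComb n)) 1) (cong suc (leaves-LComb n))

leaves-RComb : ∀ n → leaves (RComb n) ≡ suc n
leaves-RComb zero    = refl
leaves-RComb (suc n) = cong suc (leaves-RComb n)

leaves≢0 : ∀ s → leaves s ≢ 0
leaves≢0 (node l r) eq = leaves≢0 l (m+n≡0⇒m≡0 (leaves l) eq)

graft-node-< : ∀ l r {i} s → i < leaves l → graft (node l r) i s ≡ node (graft l i s) r
graft-node-< l r {i} s i<l with i <ᵇ leaves l in eq
... | true  = refl
... | false = ⊥-elim (subst T eq (<⇒<ᵇ i<l))

graft-node-≮ : ∀ l r {i} s → ¬ i < leaves l → graft (node l r) i s ≡ node l (graft r (i ∸ leaves l) s)
graft-node-≮ l r {i} s i≮l with i <ᵇ leaves l in eq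
... | true  = ⊥-elim (i≮l (<ᵇ⇒< i (leaves l) (subst T (sym eq) _)))
... | false = refl

leaves-graft : ∀ s i t → i < leaves s → suc (leaves (graft s i t)) ≡ leaves s + leaves t
leaves-graft leaf zero    t _ = refl
leaves-graft leaf (suc i) t (s≤s ())
leaves-graft (node l r) i t i<l+r with i <? leaves l
... | yes i<l rewrite graft-node-< l r t i<l = begin
  suc (leaves (graft l i t)) + leaves r ≡⟨ cong (_+ leaves r) (leaves-graft l i t i<l) ⟩
  leaves l + leaves t + leaves r        ≡⟨ xy∙z≈xz∙y +-commutativeSemigroup (leaves l) _ _ ⟩
  leaves l + leaves r + leaves t        ∎
  where open ≡-Reasoning
... | no i≮l rewrite graft-node-≮ l r t i≮l = begin
  suc (leaves l + leaves (graft r j t)) ≡⟨ sym (+-suc (leaves l) _) ⟩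
  leaves l + suc (leaves (graft r j t)) ≡⟨ cong (leaves l +_) (leaves-graft r j t j<r) ⟩
  leaves l + (leaves r + leaves t)      ≡⟨ sym (+-assoc (leaves l) _ _) ⟩
  leaves l + leaves r + leaves t        ∎
  where
  open ≡-Reasoning
  j = i ∸ leaves l
  j<r : j < leaves r
  j<r = subst (j <_) (m+n∸m≡n (leaves l) (leaves r)) (∸-monoˡ-< i<l+r (≮⇒≥ i≮l))

LComb-graft-root : ∀ a b → graft (LComb a) 0 (LComb b) ≡ LComb (a + b)
LComb-graft-root zero    b = refl
LComb-graft-root (suc a) b rewrite leaves-LComb a | LComb-graft-root a b = refl

LComb-graft-last : ∀ d t → graft (LComb (suc d)) (suc d) t ≡ node (LComb d) t
LComb-graft-last d t =
  trans (graft-node-≮ (LComb d) leaf t (<-irrefl (sym (leaves-LComb d))))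
        (cong (λ k → node (LComb d) (graft leaf k t)) d+1∸leaves≡0)
  where
  d+1∸leaves≡0 : suc d ∸ leaves (LComb d) ≡ 0
  d+1∸leaves≡0 = trans (cong (suc d ∸_) (leaves-LComb d)) (n∸n≡0 d)

RComb-graft-last : ∀ d m → graft (RComb d) d (RComb m) ≡ RComb (d + m)
RComb-graft-last zero    m = refl
RComb-graft-last (suc d) m = cong (node leaf) (RComb-graft-last d m)

module _ {c ℓ} (F : Field c ℓ) where
  open WithField F
  module K = Field F
  open K using (0#; 1#; -_)
    renaming (Carrier to 𝕂; _+_ to _+K_; _*_ to _*K_; _≈_ to _≈K_)
  module KR = Relation.Binary.Reasoning.Setoid K.setoid
  open Algebra.Properties.Ring K.ring using (-1*x≈-x)

  δ : Tree → Tree → 𝕂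
  δ t s with s ≟T t
  ... | yes _ = 1#
  ... | no  _ = 0#

  Λ : (Tree → 𝕂) → Elt → 𝕂
  Λ f []            = 0#
  Λ f ((a , s) ∷ x) = a *K f s +K Λ f x

  coeff≈Λδ : ∀ x t → coeff x t ≈K Λ (δ t) x
  coeff≈Λδ []            t = K.refl
  coeff≈Λδ ((a , s) ∷ x) t with s ≟T t
  ... | yes _ = K.+-cong (K.sym (K.*-identityʳ a)) (coeff≈Λδ x t)
  ... | no  _ = K.trans (coeff≈Λδ x t) (K.sym (K.trans (K.+-congʳ (K.zeroʳ a)) (K.+-identityˡ _)))

  Λ-++ : ∀ f x y → Λ f (x ++ y) ≈K Λ f x +K Λ f y
  Λ-++ f []            y = K.sym (K.+-identityˡ _)
  Λ-++ f ((a , s) ∷ x) y = K.trans (K.+-congˡ (Λ-++ f x y)) (K.sym (K.+-assoc _ _ _))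

  Λ-map : ∀ f g a y → Λ f (map (λ q → (a *K proj₁ q , g (proj₂ q))) y) ≈K a *K Λ (f ∘ g) y
  Λ-map f g a []            = K.sym (K.zeroʳ a)
  Λ-map f g a ((b , s) ∷ y) =
    K.trans (K.+-cong (K.*-assoc a b _) (Λ-map f g a y)) (K.sym (K.distribˡ a _ _))

  Λ-comp : ∀ f x i y → Λ f (comp x i y) ≈K Λ (λ s → Λ (λ u → f (graft s i u)) y) x
  Λ-comp f []            i y = K.refl
  Λ-comp f ((a , s) ∷ x) i y =
    K.trans (Λ-++ f (map _ y) (comp x i y)) (K.+-cong (Λ-map f (graft s i) a y) (Λ-comp f x i y))

  Λ-vanish : ∀ f x → (∀ s → f s ≈K 0#) → Λ f x ≈K 0#
  Λ-vanish f []            f≈0 = K.refl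
  Λ-vanish f ((a , s) ∷ x) f≈0 =
    K.trans (K.+-cong (K.trans (K.*-congˡ (f≈0 s)) (K.zeroʳ a)) (Λ-vanish f x f≈0)) (K.+-identityˡ 0#)

  coeff-++ : ∀ x y t → coeff (x ⊕ y) t ≈K coeff x t +K coeff y t
  coeff-++ x y t = K.trans (coeff≈Λδ (x ++ y) t)
    (K.trans (Λ-++ (δ t) x y) (K.sym (K.+-cong (coeff≈Λδ x t) (coeff≈Λδ y t))))

  coeff-scale : ∀ a x t → coeff (scale a x) t ≈K a *K coeff x t
  coeff-scale a x t = K.trans (coeff≈Λδ (scale a x) t)
    (K.trans (Λ-map (δ t) id a x) (K.*-congˡ (K.sym (coeff≈Λδ x t))))

  coeff-⊖ : ∀ x y t → coeff (x ⊖ y) t ≈K coeff x t +K - coeff y t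
  coeff-⊖ x y t = K.trans (coeff-++ x _ t)
    (K.+-congˡ (K.trans (coeff-scale (- 1#) y t) (-1*x≈-x _)))

  drop : Tree → Elt → Elt
  drop s [] = []
  drop s ((a , u) ∷ x) with u ≟T s
  ... | yes _ = drop s x
  ... | no  _ = (a , u) ∷ drop s x

  length-drop : ∀ s x → length (drop s x) ≤ length x
  length-drop s []            = z≤n
  length-drop s ((a , u) ∷ x) with u ≟T s
  ... | yes _ = m≤n⇒m≤1+n (length-drop s x)
  ... | no  _ = s≤s (length-drop s x)

  length-drop-head : ∀ a s x → length (drop s ((a , s) ∷ x)) ≤ length x
  length-drop-head a s x with s ≟T s
  ... | yes _   = length-drop s x
  ... | no  s≢s = ⊥-elim (s≢s refl)

  Λ-drop : ∀ f s x → Λ f x ≈K coeff x s *K f s +K Λ f (drop s x)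
  Λ-drop f s []            = K.sym (K.trans (K.+-congʳ (K.zeroˡ (f s))) (K.+-identityˡ 0#))
  Λ-drop f s ((a , u) ∷ x) with u ≟T s
  ... | yes refl = begin
    a *K f u +K Λ f x                                ≈⟨ K.+-congˡ (Λ-drop f u x) ⟩
    a *K f u +K (coeff x u *K f u +K Λ f (drop u x)) ≈⟨ K.sym (K.+-assoc _ _ _) ⟩
    (a *K f u +K coeff x u *K f u) +K Λ f (drop u x) ≈⟨ K.+-congʳ (K.sym (K.distribʳ (f u) a _)) ⟩
    (a +K coeff x u) *K f u +K Λ f (drop u x)        ∎
    where open KR
  ... | no _ = begin
    a *K f u +K Λ f x                                ≈⟨ K.+-congˡ (Λ-drop f s x) ⟩
    a *K f u +K (coeff x s *K f s +K Λ f (drop s x)) ≈⟨ K.sym (K.+-assoc _ _ _) ⟩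
    (a *K f u +K coeff x s *K f s) +K Λ f (drop s x) ≈⟨ K.+-congʳ (K.+-comm _ _) ⟩
    (coeff x s *K f s +K a *K f u) +K Λ f (drop s x) ≈⟨ K.+-assoc _ _ _ ⟩
    coeff x s *K f s +K (a *K f u +K Λ f (drop s x)) ∎
    where open KR

  drop-null : ∀ s x → x ≈ zeroE → drop s x ≈ zeroE
  drop-null s x x≈0 t = begin
    coeff (drop s x) t                        ≈⟨ coeff≈Λδ (drop s x) t ⟩
    Λ (δ t) (drop s x)                        ≈⟨ K.sym (K.+-identityˡ _) ⟩
    0# +K Λ (δ t) (drop s x)                  ≈⟨ K.+-congʳ (K.sym (K.trans (K.*-congʳ (x≈0 s)) (K.zeroˡ _))) ⟩
    coeff x s *K δ t s +K Λ (δ t) (drop s x)  ≈⟨ K.sym (Λ-drop (δ t) s x) ⟩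
    Λ (δ t) x                                 ≈⟨ K.sym (coeff≈Λδ x t) ⟩
    coeff x t                                 ≈⟨ x≈0 t ⟩
    0#                                        ∎
    where open KR

  Λ-null : ∀ f x → x ≈ zeroE → Λ f x ≈K 0#
  Λ-null f x = go (length x) x ≤-refl
    where
    -- Splitting off all occurrences of the head tree keeps the rest null and shortens it.
    go : ∀ n x → length x ≤ n → x ≈ zeroE → Λ f x ≈K 0#
    go _       []            _         _   = K.refl
    go (suc n) ((a , s) ∷ x) (s≤s |x|≤n) x≈0 = begin
      Λ f ((a , s) ∷ x)                                     ≈⟨ Λ-drop f s ((a , s) ∷ x) ⟩
      coeff ((a , s) ∷ x) s *K f s +K Λ f (drop s ((a , s) ∷ x))
        ≈⟨ K.+-cong (K.trans (K.*-congʳ (x≈0 s)) (K.zeroˡ (f s)))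
                    (go n (drop s ((a , s) ∷ x)) (≤-trans (length-drop-head a s x) |x|≤n)
                        (drop-null s ((a , s) ∷ x) x≈0)) ⟩
      0# +K 0#                                              ≈⟨ K.+-identityˡ 0# ⟩
      0#                                                    ∎
      where open KR

  ⊕-null : ∀ x y → x ≈ zeroE → y ≈ zeroE → (x ⊕ y) ≈ zeroE
  ⊕-null x y x≈0 y≈0 t =
    K.trans (coeff-++ x y t) (K.trans (K.+-cong (x≈0 t) (y≈0 t)) (K.+-identityˡ 0#))

  scale-null : ∀ a x → x ≈ zeroE → scale a x ≈ zeroE
  scale-null a x x≈0 t = K.trans (coeff-scale a x t) (K.trans (K.*-congˡ (x≈0 t)) (K.zeroʳ a))

  ⊕-cong : ∀ {x x' y y'} → x ≈ x' → y ≈ y' → (x ⊕ y) ≈ (x' ⊕ y')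
  ⊕-cong {x} {x'} {y} {y'} x≈x' y≈y' t =
    K.trans (coeff-++ x y t) (K.trans (K.+-cong (x≈x' t) (y≈y' t)) (K.sym (coeff-++ x' y' t)))

  ⊖-self-null : ∀ x → (x ⊖ x) ≈ zeroE
  ⊖-self-null x t = K.trans (coeff-⊖ x x t) (K.-‿inverseʳ _)

  ⟨_⟩ : Tree → Elt
  ⟨ t ⟩ = (1# , t) ∷ []

  _⊟_ : Tree → Tree → Elt
  s ⊟ t = ⟨ s ⟩ ⊖ ⟨ t ⟩

  coeff-⟨⟩-self : ∀ t → coeff ⟨ t ⟩ t ≈K 1#
  coeff-⟨⟩-self t with t ≟T t
  ... | yes _   = K.+-identityʳ 1#
  ... | no  t≢t = ⊥-elim (t≢t refl)

  coeff-⟨⟩ : ∀ s t → coeff ⟨ s ⟩ t ≈K δ t s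
  coeff-⟨⟩ s t = K.trans (coeff≈Λδ ⟨ s ⟩ t) (K.trans (K.+-identityʳ _) (K.*-identityˡ _))

  coeff-⊟ : ∀ s u t → coeff (s ⊟ u) t ≈K δ t s +K - δ t u
  coeff-⊟ s u t = K.trans (coeff-⊖ ⟨ s ⟩ ⟨ u ⟩ t) (K.+-cong (coeff-⟨⟩ s t) (K.-‿cong (coeff-⟨⟩ u t)))

  ⊟-telescope : ∀ s t u → ((s ⊟ t) ⊕ (t ⊟ u)) ≈ (s ⊟ u)
  ⊟-telescope s t u v = begin
    coeff ((s ⊟ t) ⊕ (t ⊟ u)) v                 ≈⟨ coeff-++ (s ⊟ t) (t ⊟ u) v ⟩
    coeff (s ⊟ t) v +K coeff (t ⊟ u) v          ≈⟨ K.+-cong (coeff-⊟ s t v) (coeff-⊟ t u v) ⟩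
    (x +K - y) +K (y +K - z)                    ≈⟨ K.+-assoc x (- y) _ ⟩
    x +K (- y +K (y +K - z))                    ≈⟨ K.+-congˡ (K.sym (K.+-assoc (- y) y (- z))) ⟩
    x +K ((- y +K y) +K - z)                    ≈⟨ K.+-congˡ (K.+-congʳ (K.-‿inverseˡ y)) ⟩
    x +K (0# +K - z)                            ≈⟨ K.+-congˡ (K.+-identityˡ (- z)) ⟩
    x +K - z                                    ≈⟨ K.sym (coeff-⊟ s u v) ⟩
    coeff (s ⊟ u) v                             ∎
    where
    open KR
    x y z : 𝕂
    x = δ v s
    y = δ v t
    z = δ v u

  comp-⊟ : ∀ s s' i u {v v'} → graft s i u ≡ v → graft s' i u ≡ v' →
           comp (s ⊟ s') i ⟨ u ⟩ ≈ (v ⊟ v')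
  comp-⊟ s s' i u refl refl t = begin
    coeff (comp (s ⊟ s') i ⟨ u ⟩) t        ≈⟨ coeff≈Λδ (comp (s ⊟ s') i ⟨ u ⟩) t ⟩
    Λ (δ t) (comp (s ⊟ s') i ⟨ u ⟩)        ≈⟨ K.+-cong (K.*-congʳ (K.*-identityʳ 1#))
                                                       (K.+-congʳ (K.*-congʳ (K.*-identityʳ _))) ⟩
    Λ (δ t) (graft s i u ⊟ graft s' i u)   ≈⟨ K.sym (coeff≈Λδ (graft s i u ⊟ graft s' i u) t) ⟩
    coeff (graft s i u ⊟ graft s' i u) t   ∎
    where open KR

  comp-nullˡ : ∀ x i y → x ≈ zeroE → comp x i y ≈ zeroE
  comp-nullˡ x i y x≈0 t =
    K.trans (coeff≈Λδ (comp x i y) t) (K.trans (Λ-comp (δ t) x i y) (Λ-null _ x x≈0))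

  comp-nullʳ : ∀ x i y → y ≈ zeroE → comp x i y ≈ zeroE
  comp-nullʳ x i y y≈0 t =
    K.trans (coeff≈Λδ (comp x i y) t)
      (K.trans (Λ-comp (δ t) x i y) (Λ-vanish _ x (λ s → Λ-null _ y y≈0)))

  Hom-comp : ∀ {n m} i x y → i < n → Hom n x → Hom m y → Hom (n + m ∸ 1) (comp x i y)
  Hom-comp {n} {m} i x y i<n hx hy =
    concat⁺ (map⁺ (All.map (λ {(_ , s)} s∈n → map⁺ (All.map (λ {(_ , u)} → arity s u s∈n) hy)) hx))
    where
    arity : ∀ s u → leaves s ≡ n → leaves u ≡ m → leaves (graft s i u) ≡ n + m ∸ 1
    arity s u refl refl = cong (_∸ 1) (leaves-graft s i u i<n)

  Hom0-null : ∀ {y} → Hom 0 y → y ≈ zeroE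
  Hom0-null []                    = λ _ → K.refl
  Hom0-null {(_ , s) ∷ _} (e ∷ _) = ⊥-elim (leaves≢0 s e)

  Gen-null-below : ∀ {r k n x} → Gen r k n x → n < k ⊎ r ≈ zeroE → x ≈ zeroE
  Gen-null-below (base _)  (inj₁ k<k) = ⊥-elim (<-irrefl refl k<k)
  Gen-null-below (base _)  (inj₂ r≈0) = r≈0
  Gen-null-below (zero∈ _) _          = λ _ → K.refl
  Gen-null-below (add {x = x} {y} g h) below =
    ⊕-null x y (Gen-null-below g below) (Gen-null-below h below)
  Gen-null-below (smul {x = x} a g) below = scale-null a x (Gen-null-below g below)
  Gen-null-below (resp _ x≈y g) below t = K.trans (K.sym (x≈y t)) (Gen-null-below g below t)
  Gen-null-below (compL {x = x} {y} i _ g _) (inj₂ r≈0) =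
    comp-nullˡ x i y (Gen-null-below g (inj₂ r≈0))
  Gen-null-below (compL {m = zero} {x} {y} i _ _ hy) (inj₁ _) = comp-nullʳ x i y (Hom0-null hy)
  Gen-null-below {k = k} (compL {n} {suc m} {x} {y} i _ g _) (inj₁ n+m<k) =
    comp-nullˡ x i y (Gen-null-below g (inj₁ (≤-<-trans (m≤m+n n m) n+m<k′)))
    where
    n+m<k′ : n + m < k
    n+m<k′ = subst (_< k) (+-∸-assoc n (s≤s z≤n)) n+m<k
  Gen-null-below (compR {x = x} {y} i _ _ g) (inj₂ r≈0) =
    comp-nullʳ y i x (Gen-null-below g (inj₂ r≈0))
  Gen-null-below (compR {suc n} {m} {x} {y} i _ _ g) (inj₁ n+m<k) =
    comp-nullʳ y i x (Gen-null-below g (inj₁ (≤-<-trans (m≤n+m m n) n+m<k)))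

  gen∉Gen : ∀ {r k} → 2 < k ⊎ r ≈ zeroE → ¬ Gen r k 2 (gen ⊖ zeroE)
  gen∉Gen below g = K.1≉0 (K.trans (K.sym (coeff-⟨⟩-self (node leaf leaf)))
                                    (Gen-null-below g below (node leaf leaf)))

  Gen-∋-null : ∀ {r k n x} → Hom n x → x ≈ zeroE → Gen r k n x
  Gen-∋-null {n = n} hx x≈0 = resp hx (λ t → K.sym (x≈0 t)) (zero∈ n)

  Gen-⊆ : ∀ {r k r' k'} → Gen r' k' k r → Gen r k ⇒ Gen r' k'
  Gen-⊆ r∈ (base _)          = r∈
  Gen-⊆ r∈ (zero∈ n)         = zero∈ n
  Gen-⊆ r∈ (add g h)         = add (Gen-⊆ r∈ g) (Gen-⊆ r∈ h)
  Gen-⊆ r∈ (smul a g)        = smul a (Gen-⊆ r∈ g)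
  Gen-⊆ r∈ (resp hy x≈y g)   = resp hy x≈y (Gen-⊆ r∈ g)
  Gen-⊆ r∈ (compL i i<n g hy) = compL i i<n (Gen-⊆ r∈ g) hy
  Gen-⊆ r∈ (compR i i<n hy g) = compR i i<n hy (Gen-⊆ r∈ g)

  SumI-least : ∀ {I₁ I₂ r k} → I₁ ⇒ Gen r k → I₂ ⇒ Gen r k → SumI I₁ I₂ ⇒ Gen r k
  SumI-least I₁⊆ I₂⊆ (hx , y , z , y∈ , z∈ , x≈y⊕z) =
    resp hx (λ t → K.sym (x≈y⊕z t)) (add (I₁⊆ y∈) (I₂⊆ z∈))

  inclusion-morphism : ∀ {I₁ I₂} → I₁ ⇒ I₂ → (∀ {n x} → Hom n x → x ≈ zeroE → I₂ n x) →
                       ¬ I₂ 2 (gen ⊖ zeroE) → Morphism (K⟨Mag⟩/ I₁) (K⟨Mag⟩/ I₂)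
  inclusion-morphism {I₂ = I₂} I₁⊆I₂ I₂∋null gen∉I₂ = record
    { φ         = λ _ x → x
    ; φ-arity   = λ _ _ hx → hx
    ; φ-wd      = λ _ _ _ _ _ → I₁⊆I₂
    ; φ-add     = λ _ x y hx hy → ⊖-self∈ (x ⊕ y) (++⁺ hx hy)
    ; φ-scale   = λ _ a x hx → ⊖-self∈ (scale a x) (map⁺ hx)
    ; φ-comp    = λ _ _ i x y i<n hx hy → ⊖-self∈ (comp x i y) (Hom-comp i x y i<n hx hy)
    ; φ-nonzero = gen∉I₂
    }
    where
    ⊖-self∈ : ∀ {n} x → Hom n x → I₂ n (x ⊖ x)
    ⊖-self∈ x hx = I₂∋null (++⁺ hx (map⁺ hx)) (⊖-self-null x)

  combRel : ℕ → Elt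
  combRel γ = LComb γ ⊟ RComb γ

  CAs-ideal : ℕ → Family
  CAs-ideal γ = Quot.ideal (CAs γ)

  Hom-combRel : ∀ γ → Hom (suc γ) (combRel γ)
  Hom-combRel γ = leaves-LComb γ ∷ leaves-RComb γ ∷ []

  combRel-step : ∀ d a → CAs-ideal (suc d) (suc (suc a)) (combRel (suc a)) →
                 CAs-ideal (suc d) (suc (suc (d + a))) (combRel (suc (d + a)))
  combRel-step d a combRel[1+a]∈ = resp (Hom-combRel (suc (d + a))) telescoped (add left right)
    where
    X Y : Elt
    X = comp (combRel (suc a)) 0 ⟨ LComb d ⟩
    Y = comp (combRel (suc d)) (suc d) ⟨ RComb a ⟩
    L M R : Tree
    L = LComb (suc (d + a))
    M = node (LComb d) (RComb a)
    R = RComb (suc (d + a))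
    left : CAs-ideal (suc d) (suc (suc (d + a))) X
    left = subst (λ n → CAs-ideal (suc d) n X) (cong suc (trans (+-suc a d) (cong suc (+-comm a d))))
             (compL 0 (s≤s z≤n) combRel[1+a]∈ (leaves-LComb d ∷ []))
    right : CAs-ideal (suc d) (suc (suc (d + a))) Y
    right = subst (λ n → CAs-ideal (suc d) n Y) (cong suc (+-suc d a))
              (compL (suc d) ≤-refl (base (Hom-combRel (suc d))) (leaves-RComb a ∷ []))
    X≈L⊟M : X ≈ (L ⊟ M)
    X≈L⊟M = comp-⊟ (LComb (suc a)) (RComb (suc a)) 0 (LComb d)
              (trans (LComb-graft-root (suc a) d) (cong (LComb ∘ suc) (+-comm a d))) refl
    Y≈M⊟R : Y ≈ (M ⊟ R)
    Y≈M⊟R = comp-⊟ (LComb (suc d)) (RComb (suc d)) (suc d) (RComb a)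
              (LComb-graft-last d (RComb a)) (RComb-graft-last (suc d) a)
    telescoped : (X ⊕ Y) ≈ combRel (suc (d + a))
    telescoped t = K.trans (⊕-cong {X} {L ⊟ M} {Y} {M ⊟ R} X≈L⊟M Y≈M⊟R t) (⊟-telescope L M R t)

  combRel-multiple : ∀ d q → CAs-ideal (suc d) (suc (suc (q * d))) (combRel (suc (q * d)))
  combRel-multiple d zero    = Gen-∋-null (Hom-combRel 1) (⊖-self-null ⟨ node leaf leaf ⟩)
  combRel-multiple d (suc q) = combRel-step d (q * d) (combRel-multiple d q)

  CAs-ideal-mono : ∀ {γ γ'} → 1 ≤ γ → 1 ≤ γ' → (γ ∸ 1) ∣ (γ' ∸ 1) → CAs-ideal γ' ⇒ CAs-ideal γ
  CAs-ideal-mono {suc d} (s≤s z≤n) (s≤s z≤n) (divides q refl) = Gen-⊆ (combRel-multiple d q)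

  gen∉CAs : ∀ γ → ¬ CAs-ideal γ 2 (gen ⊖ zeroE)
  gen∉CAs zero          = gen∉Gen (inj₂ (⊖-self-null ⟨ leaf ⟩))
  gen∉CAs (suc zero)    = gen∉Gen (inj₂ (⊖-self-null ⟨ node leaf leaf ⟩))
  gen∉CAs (suc (suc γ)) = gen∉Gen (inj₁ (s≤s (s≤s (s≤s z≤n))))

  CAs-gcd-⪯ᵢ-∧ᵢ : ∀ γ γ' → 1 ≤ γ → 1 ≤ γ' →
                  CAs (gcd (γ ∸ 1) (γ' ∸ 1) + 1) ⪯ᵢ (CAs γ ∧ᵢ CAs γ')
  CAs-gcd-⪯ᵢ-∧ᵢ γ γ' 1≤γ 1≤γ' = inclusion-morphism
    (SumI-least (CAs-ideal-mono 1≤g+1 1≤γ g∣γ) (CAs-ideal-mono 1≤g+1 1≤γ' g∣γ'))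
    Gen-∋-null (gen∉CAs (g + 1))
    where
    g : ℕ
    g = gcd (γ ∸ 1) (γ' ∸ 1)
    1≤g+1 : 1 ≤ g + 1
    1≤g+1 = m≤n+m 1 g
    g∣γ : (g + 1 ∸ 1) ∣ (γ ∸ 1)
    g∣γ = subst (_∣ (γ ∸ 1)) (sym (m+n∸n≡m g 1)) (gcd[m,n]∣m (γ ∸ 1) (γ' ∸ 1))
    g∣γ' : (g + 1 ∸ 1) ∣ (γ' ∸ 1)
    g∣γ' = subst (_∣ (γ' ∸ 1)) (sym (m+n∸n≡m g 1)) (gcd[m,n]∣n (γ ∸ 1) (γ' ∸ 1))

  CAs-∨ᵢ-⪯ᵢ-lcm : ∀ γ γ' → 1 ≤ γ → 1 ≤ γ' →
                  (CAs γ ∨ᵢ CAs γ') ⪯ᵢ CAs (lcm (γ ∸ 1) (γ' ∸ 1) + 1)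
  CAs-∨ᵢ-⪯ᵢ-lcm γ γ' 1≤γ 1≤γ' = inclusion-morphism
    (λ x∈ → CAs-ideal-mono 1≤γ 1≤l+1 γ∣l x∈ , CAs-ideal-mono 1≤γ' 1≤l+1 γ'∣l x∈)
    (λ hx x≈0 → Gen-∋-null hx x≈0 , Gen-∋-null hx x≈0)
    (gen∉CAs γ ∘ proj₁)
    where
    l : ℕ
    l = lcm (γ ∸ 1) (γ' ∸ 1)
    1≤l+1 : 1 ≤ l + 1
    1≤l+1 = m≤n+m 1 l
    γ∣l : (γ ∸ 1) ∣ (l + 1 ∸ 1)
    γ∣l = subst ((γ ∸ 1) ∣_) (sym (m+n∸n≡m l 1)) (m∣lcm[m,n] (γ ∸ 1) (γ' ∸ 1))
    γ'∣l : (γ' ∸ 1) ∣ (l + 1 ∸ 1)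
    γ'∣l = subst ((γ' ∸ 1) ∣_) (sym (m+n∸n≡m l 1)) (n∣lcm[m,n] (γ ∸ 1) (γ' ∸ 1))

theorem3p2p9 : ∀ {c ℓ} (F : Field c ℓ) → CharZero F →
    let open WithField F in
    (∀ γ γ' → 1 ≤ γ → 1 ≤ γ' → γ ⪯d γ' → CAs γ ⪯ᵢ CAs γ')
    × (∀ γ γ' → 1 ≤ γ → 1 ≤ γ' →
         CAs (gcd (γ ∸ 1) (γ' ∸ 1) + 1) ⪯ᵢ (CAs γ ∧ᵢ CAs γ'))
    × (∀ γ γ' → 1 ≤ γ → 1 ≤ γ' →
         (CAs γ ∨ᵢ CAs γ') ⪯ᵢ CAs (lcm (γ ∸ 1) (γ' ∸ 1) + 1))
theorem3p2p9 F _ = (λ _ _ _ _ φ → φ) , CAs-gcd-⪯ᵢ-∧ᵢ F , CAs-∨ᵢ-⪯ᵢ-lcm F
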